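{- Let $P$ be a finite bounded poset with an interpolating EL-labelling $\gamma$, let $\hat0=x_0\lessdot x_1\lessdot\cdots\lessdot x_n=\hat1$ be the increasing chain from $\hat0$ to $\hat1$, and let $l_i=\gamma(x_{i-1},x_i)$. Let $z\in P$ and $0\le i\le n$. If some unrefinable chain from $z$ to $\hat1$ has all its labels in $\{l_{i+1},\dots,l_n\}$, then $z\ge x_i$. Conversely, if $z\ge x_i$, then all labels on any unrefinable chain from $z$ to $\hat1$ lie in $\{l_{i+1},\dots,l_n\}$.
   Context: A poset is bounded if it has unique minimum $\hat0$ and maximum $\hat1$. An edge-labelling (map from covering relations to $\mathbb Z$) is an EL-labelling if for all $y<z$ there is a unique unrefinable chain from $y$ to $z$ with weakly increasing labels (the increasing chain), and its label sequence lexicographically precedes those of all other unrefinable chains from $y$ to $z$. It is interpolating if for every $y\lessdot u\lessdot z$, either $\gamma(y,u)<\gamma(u,z)$, or the increasing chain $y=w_0\lessdot\cdots\lessdot w_r=z$ has strictly increasing labels with $\gamma(w_0,w_1)=\gamma(u,z)$ and $\gamma(w_{r-1},w_r)=\gamma(y,u)$. -}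

module Defs where

open import Level using (0ℓ)
open import Data.Nat using (ℕ)
open import Data.Fin using (Fin; toℕ; inject₁; suc)
open import Data.Integer as ℤ using (ℤ)
open import Data.List using (List; []; _∷_; head; last)
open import Data.List.Relation.Unary.Linked using (Linked)
open import Data.List.Relation.Binary.Lex.Strict using (Lex-<)
open import Data.Maybe using (just)
open import Data.Product using (Σ; ∃; _×_; _,_)
open import Data.Sum using (_⊎_)
open import Relation.Binary.Structures using (IsDecPartialOrder)
open import Relation.Binary.PropositionalEquality using (_≡_; _≢_)
open import Relation.Nullary using (¬_)

-- A finite poset: carrier Fin N with a (decidable) partial order
-- (for a finite set, the order relation is decidable classically).
record FinitePoset : Set₁ where
  field
    N                 : ℕ
    _≤_               : Fin N → Fin N → Set
    isDecPartialOrder : IsDecPartialOrder _≡_ _≤_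

  Carrier : Set
  Carrier = Fin N

  _<_ : Carrier → Carrier → Set
  x < y = (x ≤ y) × (x ≢ y)

  _⋖_ : Carrier → Carrier → Set
  x ⋖ y = (x < y) × (¬ (Σ Carrier λ w → (x < w) × (w < y)))

record IsBounded (P : FinitePoset) : Set where
  open FinitePoset P
  field
    bot    : Carrier
    top    : Carrier
    bot-min : ∀ x → bot ≤ x
    top-max : ∀ x → x ≤ top

module _ (P : FinitePoset) where
  open FinitePoset P

  data Chain : Carrier → Carrier → Set where
    [_]  : ∀ y → Chain y y
    _∷⟨_⟩_ : ∀ y {w z} → y ⋖ w → Chain w z → Chain y z

  vertices : ∀ {y z} → Chain y z → List Carrier
  vertices [ y ]          = y ∷ []
  vertices (y ∷⟨ _ ⟩ c)   = y ∷ vertices c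

  -- An edge-labelling: a map from covering pairs to ℤ
  -- (represented as a function on all pairs; only its values on covers matter).
  Labelling : Set
  Labelling = Carrier → Carrier → ℤ

  module _ (γ : Labelling) where

    labels : ∀ {y z} → Chain y z → List ℤ
    labels [ _ ]                  = []
    labels (y ∷⟨ _ ⟩ [ w ])       = γ y w ∷ []
    labels (y ∷⟨ _ ⟩ (w ∷⟨ p ⟩ c)) = γ y w ∷ labels (w ∷⟨ p ⟩ c)

    WeaklyIncreasing : ∀ {y z} → Chain y z → Set
    WeaklyIncreasing c = Linked ℤ._≤_ (labels c)

    StrictlyIncreasing : ∀ {y z} → Chain y z → Set
    StrictlyIncreasing c = Linked ℤ._<_ (labels c)

    _≺lex_ : List ℤ → List ℤ → Set
    _≺lex_ = Lex-< _≡_ ℤ._<_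

    IsEL : Set
    IsEL = ∀ y z → y < z →
      Σ (Chain y z) λ c →
        WeaklyIncreasing c
        × (∀ (c′ : Chain y z) → WeaklyIncreasing c′ → vertices c′ ≡ vertices c)
        × (∀ (c′ : Chain y z) → vertices c′ ≢ vertices c → labels c ≺lex labels c′)

    IsInterpolating : Set
    IsInterpolating = ∀ y u z → y ⋖ u → u ⋖ z →
      (γ y u ℤ.< γ u z)
      ⊎ (∀ (c : Chain y z) → WeaklyIncreasing c →
           StrictlyIncreasing c
           × head (labels c) ≡ just (γ u z)
           × last (labels c) ≡ just (γ y u))

    -- all labels of a list lie in { l_{i+1}, …, l_n }, where
    -- l_{j+1} = γ(x_j, x_{j+1}) for a chain x : Fin (n+1) → P
    InLabelTail : ∀ {n} → (Fin (ℕ.suc n) → Carrier) → Fin (ℕ.suc n) → ℤ → Set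
    InLabelTail {n} x i ℓ =
      Σ (Fin n) λ j → (toℕ i Data.Nat.≤ toℕ j) × (ℓ ≡ γ (x (inject₁ j)) (x (suc j)))

{-# OPTIONS --safe #-}
-- In an interpolating EL-labelling, a descent y ⋖ u ⋖ z can be replaced by the
-- increasing chain from y to z, which starts with the smaller label γ(u,z) and
-- still carries γ(y,u). Inducting on the start of a chain and then on its first
-- label, every label of an unrefinable chain from y to w occurs on the increasing
-- chain ι from y to w, and some label of it is at most the first label of ι.
--
-- If z ≥ xᵢ, prefix a chain from z to 1̂ by the increasing chain from xᵢ to z: its
-- labels then lie on xᵢ ⋖ ⋯ ⋖ xₙ. Conversely, if xⱼ ≤ z and a chain from z to 1̂
-- has all labels above l_{j+1}, some label of the increasing chain κ from xⱼ to z
-- is at most l_{j+1}; by lexicographic minimality the first step of κ carries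
-- exactly l_{j+1}, and a first step carrying the first label of the increasing
-- chain xⱼ ⋖ ⋯ ⋖ xₙ is xⱼ ⋖ x_{j+1}. So x_{j+1} ≤ z, and induction on i finishes.
module Submission where

open import Defs
open import Data.Nat using (ℕ)
open import Data.Fin using (Fin; zero; suc; fromℕ; inject₁)
open import Data.Product using (Σ; _×_)
open import Data.List.Relation.Unary.All using (All)
open import Data.List.Relation.Unary.Linked using (Linked)
open import Data.Integer as ℤ using (ℤ)
open import Data.List using (map; allFin)
open import Relation.Binary.PropositionalEquality using (_≡_)

open import Data.Nat using (z≤n; s≤s)
import Data.Fin.Properties as Finₚ
open import Data.Fin.Induction using (po-noetherian; spo-wellFounded; <-weakInduction)
import Data.Nat.Properties as ℕₚ
import Data.Integer.Properties as ℤₚ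
open import Data.Product using (Σ-syntax; _,_; proj₁; proj₂)
open import Data.Sum using (_⊎_; inj₁; inj₂)
open import Data.Empty using (⊥-elim)
open import Data.Maybe using (just)
import Data.Maybe.Properties as Maybeₚ
open import Data.List using (List; []; _∷_; _++_; head; last)
import Data.List.Properties as Listₚ
open import Data.List.Relation.Unary.All using ([]; _∷_)
import Data.List.Relation.Unary.All as All
import Data.List.Relation.Unary.All.Properties as Allₚ
open import Data.List.Relation.Unary.Any using (Any; here; there)
import Data.List.Relation.Unary.Any as Any
import Data.List.Relation.Unary.Any.Properties as Anyₚ
open import Data.List.Relation.Unary.Linked using ([]; [-]; _∷_)
import Data.List.Relation.Unary.Linked as Linked
open import Data.List.Relation.Unary.Linked.Properties using (Linked⇒All)
open import Data.List.Relation.Binary.Lex.Core using (this; next)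
open import Data.List.Relation.Binary.Lex.Strict using (Lex-<)
open import Data.List.Membership.Propositional using (_∈_)
open import Data.List.Relation.Binary.Subset.Propositional using (_⊆_)
open import Data.List.Relation.Binary.Subset.Propositional.Properties
  using (⊆-reflexive; ⊆-trans; ∷⁺ʳ; ∈-∷⁺ʳ; xs⊆xs++ys; xs⊆ys++xs; All-resp-⊇)
open import Relation.Binary.PropositionalEquality
  using (refl; sym; trans; cong; subst; subst₂; module ≡-Reasoning)
open import Relation.Binary.Definitions using (Transitive)
open import Relation.Binary.Structures using (IsDecPartialOrder)
import Relation.Binary.Construct.On as On
open import Relation.Nullary using (yes; no)
open import Induction.WellFounded using (WellFounded; Acc; acc)
open import Function using (flip; id; _∘_)

module _ {A : Set} {R : A → A → Set} where

  Linked-∷⁻ : Transitive R → ∀ {v xs} → Linked R (v ∷ xs) → All (R v) xs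
  Linked-∷⁻ R-trans [-]         = []
  Linked-∷⁻ R-trans (Rvx ∷ Rxs) = Linked⇒All R-trans Rvx Rxs

  Linked-∷⁺ : ∀ {v xs} → All (R v) xs → Linked R xs → Linked R (v ∷ xs)
  Linked-∷⁺ []        _   = [-]
  Linked-∷⁺ (Rvx ∷ _) Rxs = Rvx ∷ Rxs

last∈ : ∀ {A : Set} {v : A} xs → last xs ≡ just v → v ∈ xs
last∈ (x ∷ [])     refl = here refl
last∈ (x ∷ y ∷ xs) eq   = there (last∈ (y ∷ xs) eq)

_≼lex_ : List ℤ → List ℤ → Set
xs ≼lex ys = xs ≡ ys ⊎ Lex-< _≡_ ℤ._<_ xs ys

≼lex-∷⇒≤ : ∀ {u v us vs} → (u ∷ us) ≼lex (v ∷ vs) → u ℤ.≤ v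
≼lex-∷⇒≤ (inj₁ refl)          = ℤₚ.≤-refl
≼lex-∷⇒≤ (inj₂ (this u<v))   = ℤₚ.<⇒≤ u<v
≼lex-∷⇒≤ (inj₂ (next refl _)) = ℤₚ.≤-refl

Any≤⇒head≤ : ∀ {v m xs} → All (v ℤ.≤_) xs → Any (ℤ._≤ m) (v ∷ xs) → v ℤ.≤ m
Any≤⇒head≤ _    (here v≤m) = v≤m
Any≤⇒head≤ v≤xs (there x≤m) = All.lookupWith ℤₚ.≤-trans v≤xs x≤m

map-allFin-suc : ∀ {A : Set} {n} (f : Fin (ℕ.suc n) → A) →
                 map f (allFin (ℕ.suc n)) ≡ f zero ∷ map (f ∘ suc) (allFin n)
map-allFin-suc f =
  cong (f zero ∷_) (trans (Listₚ.map-tabulate suc f) (sym (Listₚ.map-tabulate id (f ∘ suc))))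

module Labelled (P : FinitePoset) (γ : Labelling P) where
  open FinitePoset P
  open IsDecPartialOrder isDecPartialOrder
    using (isPartialOrder; antisym) renaming (refl to ≤-refl; trans to ≤-trans)

  ℓs : ∀ {y w} → Chain P y w → List ℤ
  ℓs = labels P γ

  Increasing : ∀ {y w} → Chain P y w → Set
  Increasing = WeaklyIncreasing P γ

  chain⇒≤ : ∀ {y w} → Chain P y w → y ≤ w
  chain⇒≤ [ _ ]         = ≤-refl
  chain⇒≤ (_ ∷⟨ p ⟩ c) = ≤-trans (proj₁ (proj₁ p)) (chain⇒≤ c)

  ⋖-chain⇒< : ∀ {y a w} → y ⋖ a → Chain P a w → y < w
  ⋖-chain⇒< ((y≤a , y≢a) , _) c =
    ≤-trans y≤a (chain⇒≤ c) , λ { refl → y≢a (antisym y≤a (chain⇒≤ c)) }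

  labels-∷ : ∀ {y a w} (p : y ⋖ a) (c : Chain P a w) → ℓs (y ∷⟨ p ⟩ c) ≡ γ y a ∷ ℓs c
  labels-∷ p [ _ ]         = refl
  labels-∷ p (_ ∷⟨ _ ⟩ _) = refl

  γ-path : List Carrier → List ℤ
  γ-path (u ∷ v ∷ vs) = γ u v ∷ γ-path (v ∷ vs)
  γ-path _            = []

  labels-vertices : ∀ {y w} (c : Chain P y w) → ℓs c ≡ γ-path (vertices P c)
  labels-vertices [ _ ]                       = refl
  labels-vertices (_ ∷⟨ _ ⟩ [ _ ])            = refl
  labels-vertices (y ∷⟨ _ ⟩ (a ∷⟨ q ⟩ c)) = cong (γ y a ∷_) (labels-vertices (a ∷⟨ q ⟩ c))

  labels-via-vertices : ∀ {y w} {c c′ : Chain P y w} → vertices P c ≡ vertices P c′ → ℓs c ≡ ℓs c′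
  labels-via-vertices {c = c} {c′} same = begin
    ℓs c                   ≡⟨ labels-vertices c ⟩
    γ-path (vertices P c)  ≡⟨ cong γ-path same ⟩
    γ-path (vertices P c′) ≡⟨ labels-vertices c′ ⟨
    ℓs c′                  ∎
    where open ≡-Reasoning

  head-vertices : ∀ {a w} (c : Chain P a w) → head (vertices P c) ≡ just a
  head-vertices [ _ ]         = refl
  head-vertices (_ ∷⟨ _ ⟩ _) = refl

  _++ᶜ_ : ∀ {y a w} → Chain P y a → Chain P a w → Chain P y w
  [ _ ]         ++ᶜ d = d
  (y ∷⟨ p ⟩ c) ++ᶜ d = y ∷⟨ p ⟩ (c ++ᶜ d)

  labels-++ᶜ : ∀ {y a w} (c : Chain P y a) (d : Chain P a w) → ℓs (c ++ᶜ d) ≡ ℓs c ++ ℓs d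
  labels-++ᶜ [ _ ]         d = refl
  labels-++ᶜ (y ∷⟨ p ⟩ c) d = begin
    ℓs (y ∷⟨ p ⟩ (c ++ᶜ d))  ≡⟨ labels-∷ p (c ++ᶜ d) ⟩
    γ y _ ∷ ℓs (c ++ᶜ d)     ≡⟨ cong (γ y _ ∷_) (labels-++ᶜ c d) ⟩
    γ y _ ∷ ℓs c ++ ℓs d     ≡⟨ cong (_++ ℓs d) (labels-∷ p c) ⟨
    ℓs (y ∷⟨ p ⟩ c) ++ ℓs d  ∎
    where open ≡-Reasoning

  ∷-labels⊆ : ∀ {y a w} (p : y ⋖ a) {c c′ : Chain P a w} → ℓs c ⊆ ℓs c′ →
              ℓs (y ∷⟨ p ⟩ c) ⊆ ℓs (y ∷⟨ p ⟩ c′)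
  ∷-labels⊆ p {c} {c′} c⊆c′ rewrite labels-∷ p c | labels-∷ p c′ = ∷⁺ʳ _ c⊆c′

  increasing-∷⁻ : ∀ {y a w} (p : y ⋖ a) (c : Chain P a w) → Increasing (y ∷⟨ p ⟩ c) →
                  All (γ y a ℤ.≤_) (ℓs c) × Increasing c
  increasing-∷⁻ p c inc rewrite labels-∷ p c = Linked-∷⁻ ℤₚ.≤-trans inc , Linked.tail inc

  increasing-∷⁺ : ∀ {y a w} (p : y ⋖ a) (c : Chain P a w) →
                  All (γ y a ℤ.≤_) (ℓs c) → Increasing c → Increasing (y ∷⟨ p ⟩ c)
  increasing-∷⁺ p c γ≤c inc rewrite labels-∷ p c = Linked-∷⁺ γ≤c inc

  _⊏[_]_ : Carrier → Carrier → Carrier → Set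
  a ⊏[ y ] b = γ y a ℤ.< γ y b

  ⊏-wellFounded : ∀ y → WellFounded _⊏[ y ]_
  ⊏-wellFounded y = spo-wellFounded (On.isStrictPartialOrder (γ y) ℤₚ.<-isStrictPartialOrder)

  ChainInductionStep : (∀ {y w} → Chain P y w → Set) → Set
  ChainInductionStep Φ = ∀ {y a w} (p : y ⋖ a) (c : Chain P a w) →
    (∀ (c′ : Chain P a w) → Φ c′) →
    (∀ {b} (s : y ⋖ b) (c′ : Chain P b w) → b ⊏[ y ] a → Φ (y ∷⟨ s ⟩ c′)) →
    Φ (y ∷⟨ p ⟩ c)

  module _ (Φ : ∀ {y w} → Chain P y w → Set) (Φ-[] : ∀ y → Φ [ y ]) (Φ-∷ : ChainInductionStep Φ)
    where

    chain-ind : ∀ {y w} (c : Chain P y w) → Φ c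
    chain-ind {y} = from y (po-noetherian isPartialOrder y)
      where
      from : ∀ y → Acc (flip _<_) y → ∀ {w} (c : Chain P y w) → Φ c
      from-∷ : ∀ y → Acc (flip _<_) y → ∀ {a w} → Acc _⊏[ y ]_ a →
               (p : y ⋖ a) (c : Chain P a w) → Φ (y ∷⟨ p ⟩ c)

      from y _      [ _ ]           = Φ-[] y
      from y up (_∷⟨_⟩_ _ {a} p c) = from-∷ y up (⊏-wellFounded y a) p c

      from-∷ y up@(acc above) (acc below) p c =
        Φ-∷ p c (from _ (above (proj₁ p))) (λ s c′ lt → from-∷ y up (below lt) s c′)

  stepLabel : ∀ {n} → (Fin (ℕ.suc n) → Carrier) → Fin n → ℤ
  stepLabel x j = γ (x (inject₁ j)) (x (suc j))

  spine : ∀ n (x : Fin (ℕ.suc n) → Carrier) → (∀ j → x (inject₁ j) ⋖ x (suc j)) →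
          ∀ k → Chain P (x k) (x (fromℕ n))
  spine ℕ.zero    x cov zero    = [ x zero ]
  spine (ℕ.suc n) x cov zero    = x zero ∷⟨ cov zero ⟩ spine n (x ∘ suc) (cov ∘ suc) zero
  spine (ℕ.suc n) x cov (suc k) = spine n (x ∘ suc) (cov ∘ suc) k

  spine-inject₁ : ∀ n x cov (j : Fin n) →
                  spine n x cov (inject₁ j) ≡ x (inject₁ j) ∷⟨ cov j ⟩ spine n x cov (suc j)
  spine-inject₁ (ℕ.suc n) x cov zero    = refl
  spine-inject₁ (ℕ.suc n) x cov (suc j) = spine-inject₁ n (x ∘ suc) (cov ∘ suc) j

  labels-spine-zero : ∀ n x cov → ℓs (spine n x cov zero) ≡ map (stepLabel x) (allFin n)
  labels-spine-zero ℕ.zero    x cov = refl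
  labels-spine-zero (ℕ.suc n) x cov = begin
    ℓs (spine (ℕ.suc n) x cov zero)
      ≡⟨ labels-∷ (cov zero) _ ⟩
    stepLabel x zero ∷ ℓs (spine n (x ∘ suc) (cov ∘ suc) zero)
      ≡⟨ cong (stepLabel x zero ∷_) (labels-spine-zero n (x ∘ suc) (cov ∘ suc)) ⟩
    stepLabel x zero ∷ map (stepLabel (x ∘ suc)) (allFin n)
      ≡⟨ map-allFin-suc (stepLabel x) ⟨
    map (stepLabel x) (allFin (ℕ.suc n))
      ∎
    where open ≡-Reasoning

  spine-increasing : ∀ n x cov → Increasing (spine n x cov zero) →
                     ∀ k → Increasing (spine n x cov k)
  spine-increasing n         x cov inc zero    = inc
  spine-increasing (ℕ.suc n) x cov inc (suc k) =
    spine-increasing n (x ∘ suc) (cov ∘ suc) (proj₂ (increasing-∷⁻ (cov zero) _ inc)) k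

  ∈spine⇒InLabelTail : ∀ n x cov k {ℓ} → ℓ ∈ ℓs (spine n x cov k) → InLabelTail P γ x k ℓ
  ∈spine⇒InLabelTail (ℕ.suc n) x cov zero ℓ∈ with subst (_ ∈_) (labels-∷ (cov zero) _) ℓ∈
  ... | here ℓ≡    = zero , z≤n , ℓ≡
  ... | there ℓ∈′ =
    let j , _ , ℓ≡ = ∈spine⇒InLabelTail n (x ∘ suc) (cov ∘ suc) zero ℓ∈′ in suc j , z≤n , ℓ≡
  ∈spine⇒InLabelTail (ℕ.suc n) x cov (suc k) ℓ∈ =
    let j , k≤j , ℓ≡ = ∈spine⇒InLabelTail n (x ∘ suc) (cov ∘ suc) k ℓ∈ in suc j , s≤s k≤j , ℓ≡

  InLabelTail⇒∈spine : ∀ n x cov k {ℓ} → InLabelTail P γ x k ℓ → ℓ ∈ ℓs (spine n x cov k)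
  InLabelTail⇒∈spine (ℕ.suc n) x cov zero (zero , _ , ℓ≡) =
    subst (_ ∈_) (sym (labels-∷ (cov zero) _)) (here ℓ≡)
  InLabelTail⇒∈spine (ℕ.suc n) x cov zero (suc j , _ , ℓ≡) =
    subst (_ ∈_) (sym (labels-∷ (cov zero) _))
      (there (InLabelTail⇒∈spine n (x ∘ suc) (cov ∘ suc) zero (j , z≤n , ℓ≡)))
  InLabelTail⇒∈spine (ℕ.suc n) x cov (suc k) (suc j , s≤s k≤j , ℓ≡) =
    InLabelTail⇒∈spine n (x ∘ suc) (cov ∘ suc) k (j , k≤j , ℓ≡)

  InLabelTail-suc⇒inject₁ : ∀ {n} {x : Fin (ℕ.suc n) → Carrier} {j ℓ} →
                            InLabelTail P γ x (suc j) ℓ → InLabelTail P γ x (inject₁ j) ℓ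
  InLabelTail-suc⇒inject₁ (k , j<k , ℓ≡) =
    k , ℕₚ.≤-trans (ℕₚ.<⇒≤ (Finₚ.≤̄⇒inject₁< Finₚ.≤-refl)) j<k , ℓ≡

  module EL (isEL : IsEL P γ) where

    increasingChain : ∀ {y w} → y ≤ w → Σ (Chain P y w) Increasing
    increasingChain {y} {w} y≤w with y Finₚ.≟ w
    ... | yes refl = [ y ] , []
    ... | no y≢w   = let c , inc , _ = isEL y w (y≤w , y≢w) in c , inc

    increasing-unique : ∀ {y w} (c c′ : Chain P y w) → Increasing c → Increasing c′ →
                        vertices P c ≡ vertices P c′
    increasing-unique [ _ ]         [ _ ]           _   _    = refl
    increasing-unique [ _ ]         (_ ∷⟨ p ⟩ c′) _   _    = ⊥-elim (proj₂ (⋖-chain⇒< p c′) refl)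
    increasing-unique (_ ∷⟨ p ⟩ c) [ _ ]           _   _    = ⊥-elim (proj₂ (⋖-chain⇒< p c) refl)
    increasing-unique {y} {w} c@(_ ∷⟨ p ⟩ d) c′@(_ ∷⟨ _ ⟩ _) inc inc′ =
      let _ , _ , unique , _ = isEL y w (⋖-chain⇒< p d) in
      trans (unique c inc) (sym (unique c′ inc′))

    increasing-labels-unique : ∀ {y w} (c c′ : Chain P y w) → Increasing c → Increasing c′ →
                               ℓs c ≡ ℓs c′
    increasing-labels-unique c c′ inc inc′ = labels-via-vertices (increasing-unique c c′ inc inc′)

    increasing-first≤ : ∀ {y a b w} (q : y ⋖ a) (ι : Chain P a w) → Increasing (y ∷⟨ q ⟩ ι) →
                        (p : y ⋖ b) (c : Chain P b w) → γ y a ℤ.≤ γ y b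
    increasing-first≤ {y} {w = w} q ι inc p c with isEL y w (⋖-chain⇒< q ι)
    ... | ε , inc-ε , _ , lexMin = ≼lex-∷⇒≤ (subst₂ _≼lex_ ε≡ι (labels-∷ p c) ε≼c)
      where
      ε≡ι : ℓs ε ≡ γ y _ ∷ ℓs ι
      ε≡ι = trans (increasing-labels-unique ε (y ∷⟨ q ⟩ ι) inc-ε inc) (labels-∷ q ι)

      ε≼c : ℓs ε ≼lex ℓs (y ∷⟨ p ⟩ c)
      ε≼c with Listₚ.≡-dec Finₚ._≟_ (vertices P (y ∷⟨ p ⟩ c)) (vertices P ε)
      ... | yes same  = inj₁ (sym (labels-via-vertices same))
      ... | no differ = inj₂ (lexMin _ differ)

    module Interpolating (interp : IsInterpolating P γ) where

      -- If the labels ascend weakly, the two-step chain is itself the increasing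
      -- chain, so interpolation makes it strictly increasing.
      ascent-strict : ∀ {y u z} → y ⋖ u → u ⋖ z → γ y u ℤ.≤ γ u z → γ y u ℤ.< γ u z
      ascent-strict {y} {u} {z} p q ascent with interp y u z p q
      ... | inj₁ strict = strict
      ... | inj₂ forced = Linked.head (proj₁ (forced (y ∷⟨ p ⟩ (u ∷⟨ q ⟩ [ z ])) (ascent ∷ [-])))

      increasing-head< : ∀ {y a w} (q : y ⋖ a) (ι : Chain P a w) → Increasing (y ∷⟨ q ⟩ ι) →
                         All (γ y a ℤ.<_) (ℓs ι)
      increasing-head< q [ _ ]              _   = []
      increasing-head< q ι@(_ ∷⟨ q′ ⟩ ι′) inc =
        let y≤ι , inc-ι = increasing-∷⁻ q ι inc
            b≤ι′ , _    = increasing-∷⁻ q′ ι′ inc-ι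
            y<b         = ascent-strict q q′ (All.head (subst (All _) (labels-∷ q′ ι′) y≤ι))
        in subst (All _) (sym (labels-∷ q′ ι′)) (y<b ∷ All.map (ℤₚ.<-≤-trans y<b) b≤ι′)

      interpolate : ∀ {y u z} (p : y ⋖ u) (q : u ⋖ z) → γ u z ℤ.< γ y u →
                    Σ[ b ∈ Carrier ] Σ[ s ∈ y ⋖ b ] Σ[ r ∈ Chain P b z ]
                      γ y b ≡ γ u z × γ y u ∈ ℓs r × All (γ y b ℤ.<_) (ℓs r)
      interpolate {y} {u} {z} p q descent with interp y u z p q
      ... | inj₁ ascent = ⊥-elim (ℤₚ.<-asym descent ascent)
      ... | inj₂ forced with increasingChain (proj₁ (⋖-chain⇒< p (u ∷⟨ q ⟩ [ z ])))
      ... | [ _ ] , _ = ⊥-elim (proj₂ (⋖-chain⇒< p (u ∷⟨ q ⟩ [ z ])) refl)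
      ... | (_ ∷⟨ s ⟩ r) , inc with forced (y ∷⟨ s ⟩ r) inc
      ... | _ , first , final = _ , s , r , first-label , last-in-r , increasing-head< s r inc
        where
        first-label : γ y _ ≡ γ u z
        first-label = Maybeₚ.just-injective (trans (cong head (sym (labels-∷ s r))) first)

        last-in-r : γ y u ∈ ℓs r
        last-in-r with subst (γ y u ∈_) (labels-∷ s r) (last∈ _ final)
        ... | here same = ⊥-elim (ℤₚ.<-irrefl (sym (trans same first-label)) descent)
        ... | there ∈r  = ∈r

      record Reroute {y a w} (p : y ⋖ a) (e : Chain P a w) : Set where
        field
          b       : Carrier
          step    : y ⋖ b
          rest    : Chain P b w
          smaller : b ⊏[ y ] a
          covers  : ℓs (y ∷⟨ p ⟩ e) ⊆ ℓs (y ∷⟨ step ⟩ rest)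
          minimal : All (γ y b ℤ.≤_) (ℓs rest)
          first∈  : γ y b ∈ ℓs e

      increasing-or-reroute : ∀ {y a w} (p : y ⋖ a) (e : Chain P a w) → Increasing e →
                              Increasing (y ∷⟨ p ⟩ e) ⊎ Reroute p e
      increasing-or-reroute p [ _ ] _ = inj₁ [-]
      increasing-or-reroute {y} {a} p (_∷⟨_⟩_ _ {d} q e′) inc with γ y a ℤ.≤? γ a d
      ... | yes ascent =
        inj₁ (subst (λ ℓs-e → Linked ℤ._≤_ (γ y a ∷ ℓs-e)) (sym (labels-∷ q e′))
                    (ascent ∷ subst (Linked ℤ._≤_) (labels-∷ q e′) inc))
      ... | no ¬ascent with interpolate p q (ℤₚ.≰⇒> ¬ascent)
      ... | b , s , r , first , a∈r , b<r = inj₂ record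
        { b       = b
        ; step    = s
        ; rest    = r ++ᶜ e′
        ; smaller = subst (ℤ._< γ y a) (sym first) (ℤₚ.≰⇒> ¬ascent)
        ; covers  = covers
        ; minimal = subst (All _) (sym (labels-++ᶜ r e′)) (Allₚ.++⁺ (All.map ℤₚ.<⇒≤ b<r) b≤e′)
        ; first∈  = subst (γ y b ∈_) (sym (labels-∷ q e′)) (here first)
        }
        where
        b≤e′ : All (γ y b ℤ.≤_) (ℓs e′)
        b≤e′ = subst (λ v → All (v ℤ.≤_) (ℓs e′)) (sym first) (proj₁ (increasing-∷⁻ q e′ inc))

        covers : ℓs (y ∷⟨ p ⟩ (a ∷⟨ q ⟩ e′)) ⊆ ℓs (y ∷⟨ s ⟩ (r ++ᶜ e′))
        covers rewrite labels-∷ q e′ | labels-∷ s (r ++ᶜ e′) | labels-++ᶜ r e′ =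
          ∈-∷⁺ʳ (there (xs⊆xs++ys _ _ a∈r))
            (∈-∷⁺ʳ (here (sym first)) (λ ∈e′ → there (xs⊆ys++xs _ (ℓs r) ∈e′)))

      open Reroute

      labels⊆increasing : ∀ {y w} (c ι : Chain P y w) → Increasing ι → ℓs c ⊆ ℓs ι
      labels⊆increasing c ι = chain-ind Φ (λ _ _ _ ()) Φ-∷ c ι
        where
        Φ : ∀ {y w} → Chain P y w → Set
        Φ {y} {w} c = (ι : Chain P y w) → Increasing ι → ℓs c ⊆ ℓs ι

        Φ-∷ : ChainInductionStep Φ
        Φ-∷ {y} p c outer inner ι inc with increasingChain (chain⇒≤ c)
        ... | e , inc-e = ⊆-trans (∷-labels⊆ p (outer c e inc-e)) e-covered
          where
          e-covered : ℓs (y ∷⟨ p ⟩ e) ⊆ ℓs ι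
          e-covered with increasing-or-reroute p e inc-e
          ... | inj₁ inc-pe = ⊆-reflexive (increasing-labels-unique _ ι inc-pe inc)
          ... | inj₂ r      = ⊆-trans (covers r) (inner (step r) (rest r) (smaller r) ι inc)

      Any≤-from-increasing : ∀ {y w m} (c ι : Chain P y w) → Increasing ι →
                             Any (ℤ._≤ m) (ℓs ι) → Any (ℤ._≤ m) (ℓs c)
      Any≤-from-increasing c ι = chain-ind Φ Φ-[] Φ-∷ c ι
        where
        Φ : ∀ {y w} → Chain P y w → Set
        Φ {y} {w} c = ∀ {m} (ι : Chain P y w) → Increasing ι →
                      Any (ℤ._≤ m) (ℓs ι) → Any (ℤ._≤ m) (ℓs c)

        Φ-[] : ∀ y → Φ [ y ]
        Φ-[] y [ _ ]         _ ()
        Φ-[] y (_ ∷⟨ p ⟩ ι) _ _ = ⊥-elim (proj₂ (⋖-chain⇒< p ι) refl)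

        Φ-∷ : ChainInductionStep Φ
        Φ-∷ {y} {a} p c outer inner {m} ι inc low with increasingChain (chain⇒≤ c)
        ... | e , inc-e = subst (Any _) (sym (labels-∷ p c)) low-in-pc
          where
          low-in-pc : Any (ℤ._≤ m) (γ y a ∷ ℓs c)
          low-in-pc with increasing-or-reroute p e inc-e
          ... | inj₁ inc-pe
            with subst (Any _) (trans (increasing-labels-unique ι _ inc inc-pe) (labels-∷ p e)) low
          ...   | here  a≤m   = here a≤m
          ...   | there low-e = there (outer c e inc-e low-e)
          low-in-pc | inj₂ r = there (outer c e inc-e (Any.map (λ { refl → b≤m }) (first∈ r)))
            where
            b≤m : γ y (b r) ℤ.≤ m
            b≤m = Any≤⇒head≤ (minimal r) (subst (Any _) (labels-∷ (step r) (rest r))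
                                            (inner (step r) (rest r) (smaller r) ι inc low))

      first-step-unique : ∀ {y a b w} (q : y ⋖ a) (ι : Chain P a w) → Increasing (y ∷⟨ q ⟩ ι) →
                          (s : y ⋖ b) → b ≤ w → γ y b ≡ γ y a → b ≡ a
      first-step-unique {y} {a} {b} q ι inc s b≤w same with increasingChain b≤w
      ... | τ , inc-τ = Maybeₚ.just-injective (begin
        just b               ≡⟨ head-vertices τ ⟨
        head (vertices P τ)  ≡⟨ cong head (Listₚ.∷-injectiveʳ (increasing-unique _ _ inc-sτ inc)) ⟩
        head (vertices P ι)  ≡⟨ head-vertices ι ⟩
        just a               ∎)
        where
        open ≡-Reasoning

        b≤qι : All (γ y b ℤ.≤_) (ℓs (y ∷⟨ q ⟩ ι))
        b≤qι = subst (All _) (sym (labels-∷ q ι))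
                 (subst (λ v → All (v ℤ.≤_) (γ y a ∷ ℓs ι)) (sym same)
                   (ℤₚ.≤-refl ∷ proj₁ (increasing-∷⁻ q ι inc)))

        -- The labels of s followed by τ occur on the increasing chain, whose
        -- least label is γ y a = γ y b, so this chain is increasing too.
        inc-sτ : Increasing (y ∷⟨ s ⟩ τ)
        inc-sτ = increasing-∷⁺ s τ
          (All-resp-⊇ (⊆-trans (λ ∈τ → subst (_ ∈_) (sym (labels-∷ s τ)) (there ∈τ))
                                (labels⊆increasing (y ∷⟨ s ⟩ τ) _ inc)) b≤qι)
          inc-τ

      above-first-step : ∀ {y a z w} (q : y ⋖ a) (ι : Chain P a w) → Increasing (y ∷⟨ q ⟩ ι) →
                         y ≤ z → (c : Chain P z w) → All (γ y a ℤ.<_) (ℓs c) → a ≤ z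
      above-first-step {y} {a} {z} q ι inc y≤z c a<c with increasingChain y≤z
      ... | κ , inc-κ = first-step κ inc-κ low-in-κ
        where
        low-in-qι : Any (ℤ._≤ γ y a) (ℓs (y ∷⟨ q ⟩ ι))
        low-in-qι = subst (Any _) (sym (labels-∷ q ι)) (here ℤₚ.≤-refl)

        low-in-κ : Any (ℤ._≤ γ y a) (ℓs κ)
        low-in-κ with Anyₚ.++⁻ (ℓs κ)
          (subst (Any _) (labels-++ᶜ κ c) (Any≤-from-increasing (κ ++ᶜ c) _ inc low-in-qι))
        ... | inj₁ in-κ = in-κ
        ... | inj₂ in-c = ⊥-elim (All.lookupWith ℤₚ.<⇒≱ a<c in-c)

        first-step : (κ : Chain P y z) → Increasing κ → Any (ℤ._≤ γ y a) (ℓs κ) → a ≤ z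
        first-step [ _ ]           _     ()
        first-step (_∷⟨_⟩_ _ {b} s κ′) inc-κ low = subst (_≤ z) b≡a (chain⇒≤ κ′)
          where
          b≤a : γ y b ℤ.≤ γ y a
          b≤a = Any≤⇒head≤ (proj₁ (increasing-∷⁻ s κ′ inc-κ)) (subst (Any _) (labels-∷ s κ′) low)
          b≡a : b ≡ a
          b≡a = first-step-unique q ι inc s (chain⇒≤ (κ′ ++ᶜ c))
                  (ℤₚ.≤-antisym b≤a (increasing-first≤ q ι inc s (κ′ ++ᶜ c)))

      module _ (n : ℕ) (x : Fin (ℕ.suc n) → Carrier) (cov : ∀ j → x (inject₁ j) ⋖ x (suc j))
               (inc : Increasing (spine n x cov zero)) where

        above⇒labels-in-tail : ∀ {z} i → x i ≤ z → (c : Chain P z (x (fromℕ n))) →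
                             All (InLabelTail P γ x i) (ℓs c)
        above⇒labels-in-tail i xᵢ≤z c = All.tabulate λ ℓ∈c →
          ∈spine⇒InLabelTail n x cov i
            (labels⊆increasing (κ ++ᶜ c) (spine n x cov i) (spine-increasing n x cov inc i)
              (subst (_ ∈_) (sym (labels-++ᶜ κ c)) (xs⊆ys++xs _ (ℓs κ) ℓ∈c)))
          where
          κ : Chain P (x i) _
          κ = proj₁ (increasingChain xᵢ≤z)

        labels-in-tail⇒above : ∀ {z} (c : Chain P z (x (fromℕ n))) → x zero ≤ z →
                      ∀ i → All (InLabelTail P γ x i) (ℓs c) → x i ≤ z
        labels-in-tail⇒above {z} c x₀≤z = <-weakInduction _ (λ _ → x₀≤z) climb
          where
          climb : ∀ j → (All (InLabelTail P γ x (inject₁ j)) (ℓs c) → x (inject₁ j) ≤ z) →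
                  All (InLabelTail P γ x (suc j)) (ℓs c) → x (suc j) ≤ z
          climb j ih c-in-tail = above-first-step (cov j) (spine n x cov (suc j)) inc-j xⱼ≤z c c-above
            where
            xⱼ≤z : x (inject₁ j) ≤ z
            xⱼ≤z = ih (All.map (InLabelTail-suc⇒inject₁ {x = x}) c-in-tail)

            inc-j : Increasing (x (inject₁ j) ∷⟨ cov j ⟩ spine n x cov (suc j))
            inc-j = subst Increasing (spine-inject₁ n x cov j)
                      (spine-increasing n x cov inc (inject₁ j))

            c-above : All (stepLabel x j ℤ.<_) (ℓs c)
            c-above = All.map (All.lookup (increasing-head< (cov j) _ inc-j)
                                ∘ InLabelTail⇒∈spine n x cov (suc j)) c-in-tail

corollary1 : (P : FinitePoset) (B : IsBounded P) (γ : Labelling P) →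
    IsEL P γ → IsInterpolating P γ →
    -- the increasing chain 0̂ = x₀ ⋖ x₁ ⋖ ⋯ ⋖ xₙ = 1̂
    (n : ℕ) (x : Fin (ℕ.suc n) → FinitePoset.Carrier P) →
    x zero ≡ IsBounded.bot B → x (fromℕ n) ≡ IsBounded.top B →
    (cov : (j : Fin n) → FinitePoset._⋖_ P (x (inject₁ j)) (x (suc j))) →
    Linked ℤ._≤_ (map (λ j → γ (x (inject₁ j)) (x (suc j))) (allFin n)) →
    (z : FinitePoset.Carrier P) (i : Fin (ℕ.suc n)) →
    ((Σ (Chain P z (IsBounded.top B)) λ c → All (InLabelTail P γ x i) (labels P γ c))
       → FinitePoset._≤_ P (x i) z)
    × (FinitePoset._≤_ P (x i) z →
       ∀ (c : Chain P z (IsBounded.top B)) → All (InLabelTail P γ x i) (labels P γ c))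
corollary1 P B γ isEL interp n x x₀≡0̂ xₙ≡1̂ cov ascending z i rewrite sym xₙ≡1̂ =
  (λ (c , c-in-tail) → labels-in-tail⇒above n x cov inc c x₀≤z i c-in-tail) ,
  (λ xᵢ≤z c → above⇒labels-in-tail n x cov inc i xᵢ≤z c)
  where
  open FinitePoset P using (_≤_)
  open Labelled P γ
  open EL isEL
  open Interpolating interp

  inc : Increasing (spine n x cov zero)
  inc = subst (Linked ℤ._≤_) (sym (labels-spine-zero n x cov)) ascending

  x₀≤z : x zero ≤ z
  x₀≤z = subst (_≤ z) (sym x₀≡0̂) (IsBounded.bot-min B z)
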